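{- Suppose that $q_1$ and $q_2$ are coprime prime powers, each congruent to $1\pmod 3$, such that $4(2q_1-q_2) = u_3(q_1)u_3(q_2)+27v_3(\alpha_1)v_3(\alpha_2)$ for some primitive elements $\alpha_1$ of $\operatorname{GF}(q_1)$ and $\alpha_2$ of $\operatorname{GF}(q_2)$. Suppose that $q_1q_2$ is even. Then $(q_1,q_2)$ is one of $(4,7)$, $(4,13)$, $(7,16)$, $(13,16)$.
   Context: For a prime power $q = p^r \equiv 1 \pmod 3$, $u_3(q)$ is the unique integer with $u_3(q)\equiv 1\pmod 3$ such that $4q = u_3(q)^2+27v^2$ for some integer $v$, and $\gcd(u_3(q),p)=1$ when $p\equiv 1\pmod 3$; for a primitive element $\alpha$ of $\operatorname{GF}(q)$, $v_3(\alpha)$ is an integer with $4q = u_3(q)^2 + 27 v_3(\alpha)^2$ whose sign is chosen so that $c_3(\alpha;0,1) = (2q-4-u_3(q)-9v_3(\alpha))/18$, where $c_3(\alpha;a,b)=|\{\alpha^k+1: k\equiv a \pmod 3\}\cap\{\alpha^k: k\equiv b\pmod 3\}|$. -}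

module Defs where

open import Level using (0ℓ)
open import Algebra.Bundles using (CommutativeRing)
open import Data.Nat as ℕ using (ℕ; zero; suc; _∸_; _%_; _<_; _≤_)
open import Data.Nat.Primality using (Prime)
open import Data.Nat.Coprimality using (Coprime)
open import Data.Integer as ℤ using (ℤ; +_)
open import Data.Fin using (Fin)
open import Data.List using (List; length; filter; upTo; allFin)
open import Data.List.Relation.Unary.Any using (Any; any?)
open import Data.Product using (Σ; ∃; _×_; _,_)
open import Relation.Nullary using (¬_; Dec; _×-dec_)
open import Relation.Binary.PropositionalEquality using (_≡_)

record FiniteField (q : ℕ) : Set₁ where
  field
    commRing : CommutativeRing 0ℓ 0ℓ
  open CommutativeRing commRing public
  field
    _≟_     : (x y : Carrier) → Dec (x ≈ y)
    0≉1     : ¬ (0# ≈ 1#)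
    inverse : (x : Carrier) → ¬ (x ≈ 0#) → Σ Carrier λ y → (x * y) ≈ 1#
    elem    : Fin q → Carrier
    elem-injective  : (i j : Fin q) → elem i ≈ elem j → i ≡ j
    elem-surjective : (x : Carrier) → Σ (Fin q) λ i → elem i ≈ x

module _ {q : ℕ} (F : FiniteField q) where
  open FiniteField F

  pow : Carrier → ℕ → Carrier
  pow x zero    = 1#
  pow x (suc n) = x * pow x n

  Primitive : Carrier → Set
  Primitive α = (pow α (q ∸ 1) ≈ 1#)
              × ((k : ℕ) → 1 ≤ k → k < q ∸ 1 → ¬ (pow α k ≈ 1#))

  -- x ∈ {α^k + s : k ≡ a (mod 3)}, with k ranging over 0 … q-2
  -- (a full period of α, so this is the same set as for all k ∈ ℕ)
  InCoset : Carrier → ℕ → Carrier → Carrier → Set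
  InCoset α a s x = Any (λ k → (k % 3 ≡ a) × (x ≈ (pow α k + s))) (upTo (q ∸ 1))

  inCoset? : (α : Carrier) (a : ℕ) (s x : Carrier) → Dec (InCoset α a s x)
  inCoset? α a s x = any? (λ k → ((k % 3) ℕ.≟ a) ×-dec (x ≟ (pow α k + s))) (upTo (q ∸ 1))

  -- cyclotomic number c_3(α; a, b)
  --   = |{α^k + 1 : k ≡ a (mod 3)} ∩ {α^k : k ≡ b (mod 3)}|
  c3 : Carrier → ℕ → ℕ → ℕ
  c3 α a b = length (filter (λ i → inCoset? α a 1# (elem i) ×-dec inCoset? α b 0# (elem i))
                            (allFin q))

IsPrimePower : ℕ → ℕ → Set
IsPrimePower p q = Prime p × ∃ λ r → (1 ≤ r) × (q ≡ p ℕ.^ r)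

IsU3 : (p q : ℕ) → ℤ → Set
IsU3 p q u = (u ℤ.% + 3 ≡ 1)
           × (∃ λ (v : ℤ) → + (4 ℕ.* q) ≡ (u ℤ.* u) ℤ.+ (+ 27 ℤ.* (v ℤ.* v)))
           × (p % 3 ≡ 1 → Coprime ℤ.∣ u ∣ p)

-- v is v_3(α) (relative to u = u_3(q)): 4q = u² + 27 v² and
-- c_3(α;0,1) = (2q - 4 - u - 9v)/18, i.e. 18·c_3(α;0,1) = 2q - 4 - u - 9v
IsV3 : {q : ℕ} (F : FiniteField q) → FiniteField.Carrier F → ℤ → ℤ → Set
IsV3 {q} F α u v = (+ (4 ℕ.* q) ≡ (u ℤ.* u) ℤ.+ (+ 27 ℤ.* (v ℤ.* v)))
                 × (+ 18 ℤ.* + (c3 F α 0 1) ≡ ((+ (2 ℕ.* q) ℤ.- + 4) ℤ.- u) ℤ.- (+ 9 ℤ.* v))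

{-# OPTIONS --safe #-}
-- Exactly one of q₁, q₂ is a power of 2, and for it 4·2^r = u² + 27v² forces
-- v = 0, since 8 ∣ a² + 27b² only when a and b are both even, so one can descend.
-- The cross relation then reads 4(2q₁ − q₂) = u₁u₂ with u² = 4·2^r on the even
-- side. Squaring it and writing k = q₁ if q₁ is even, k = q₂/4 if q₂ is, gives
-- 4|m − 2k|² = k·a², where m is the odd prime power and a² ≤ 4m. As |m − 2k| is
-- odd, k divides 4, so k ∈ {1, 4} because k ≡ 1 (mod 3); the same equation gives
-- |m − 2k|² ≤ k·m, hence m ≤ 4k, and among odd m ≡ 1 (mod 3) with m ≠ 1 this
-- leaves k = 4 and m ∈ {7, 13}.
module Submission where

open import Defs
open import Data.Nat as ℕ using (ℕ; _%_)
open import Data.Nat.Divisibility using (_∣_)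
open import Data.Nat.Coprimality using (Coprime)
open import Data.Integer as ℤ using (ℤ; +_)
open import Data.Product using (_×_; _,_)
open import Data.Sum using (_⊎_)
open import Relation.Binary.PropositionalEquality using (_≡_)

open import Data.Nat using (zero; suc; _+_; _*_; _∸_; _^_; _≤_; _<_; _≟_; ∣_-_∣; NonZero; z≤n; s≤s; z<s; _≤?_)
open import Data.Nat.Properties
open import Data.Nat.DivMod using (_/_; m≡m%n+[m/n]*n; m%n<n; [m+kn]%n≡m%n)
open import Data.Nat.Divisibility
  using (_∣_; _∣?_; divides; ∣m+n∣m⇒∣n; ∣m∸n∣n⇒∣m; ∣m∣n⇒∣m+n; *-cancelˡ-∣; ∣-trans; m∣m*n; ∣1⇒≡1; n∣m⇒m%n≡0)
open import Data.Nat.Primality using (Prime; euclidsLemma; prime[2]; ¬prime[1]; prime⇒irreducible)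
open import Data.Nat.Tactic.RingSolver using (solve-∀; solve)
import Data.Integer.Properties as ℤₚ
open import Data.Sign.Properties using (s*s≡+)
open import Data.List using (_∷_; [])
open import Data.Sum using (inj₁; inj₂; [_,_])
import Data.Sum as Sum
open import Data.Product using (proj₁; proj₂)
import Data.Product as Product
open import Data.Empty using (⊥-elim)
open import Relation.Nullary using (¬_; ¬?; yes; no; contradiction)
open import Relation.Nullary.Decidable using (toWitness; _→-dec_; _⊎-dec_; _×-dec_)
open import Relation.Binary.PropositionalEquality
  using (_≢_; refl; sym; trans; cong; cong₂; subst; subst₂; module ≡-Reasoning)

p^m∣p^n*d⇒m≤n : ∀ {p} .{{_ : NonZero p}} m n {d} → p ^ m ∣ p ^ n * d → ¬ p ∣ d → m ≤ n
p^m∣p^n*d⇒m≤n zero    n       _ _ = z≤n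
p^m∣p^n*d⇒m≤n {p} (suc m) zero {d} p^[1+m]∣d p∤d =
  contradiction (∣-trans (m∣m*n (p ^ m)) (subst (p ^ suc m ∣_) (*-identityˡ d) p^[1+m]∣d)) p∤d
p^m∣p^n*d⇒m≤n {p} (suc m) (suc n) {d} p^[1+m]∣p^[1+n]*d p∤d =
  s≤s (p^m∣p^n*d⇒m≤n m n (*-cancelˡ-∣ p (subst (p ^ suc m ∣_) (*-assoc p (p ^ n) d) p^[1+m]∣p^[1+n]*d)) p∤d)

∣∣m-n∣∣n⇒∣m : ∀ {d m n} → d ∣ ∣ m - n ∣ → d ∣ n → d ∣ m
∣∣m-n∣∣n⇒∣m {d} {m} {n} d∣∣m-n∣ d∣n with ≤-total m n
... | inj₁ m≤n =
  ∣m+n∣m⇒∣n (subst (d ∣_) (sym (m∸n+n≡m m≤n)) d∣n) (subst (d ∣_) (m≤n⇒∣m-n∣≡n∸m m≤n) d∣∣m-n∣)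
... | inj₂ n≤m = ∣m∸n∣n⇒∣m d n≤m (subst (d ∣_) (m≤n⇒∣n-m∣≡n∸m n≤m) d∣∣m-n∣) d∣n

p∤n⇒p∤n*n : ∀ {p n} → Prime p → ¬ p ∣ n → ¬ p ∣ n * n
p∤n⇒p∤n*n {n = n} p-prime p∤n p∣n*n = [ p∤n , p∤n ] (euclidsLemma n n p-prime p∣n*n)

prime∣p^n⇒≡p : ∀ {d p} n → Prime d → Prime p → d ∣ p ^ n → d ≡ p
prime∣p^n⇒≡p zero    d-prime _       d∣1 = contradiction (subst Prime (∣1⇒≡1 d∣1) d-prime) ¬prime[1]
prime∣p^n⇒≡p {p = p} (suc n) d-prime p-prime d∣p^[1+n] with euclidsLemma p (p ^ n) d-prime d∣p^[1+n]
... | inj₂ d∣p^n = prime∣p^n⇒≡p n d-prime p-prime d∣p^n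
... | inj₁ d∣p   with prime⇒irreducible p-prime d∣p
...   | inj₁ d≡1 = contradiction (subst Prime d≡1 d-prime) ¬prime[1]
...   | inj₂ d≡p = d≡p

primePower≢1 : ∀ {p q} → IsPrimePower p q → q ≢ 1
primePower≢1 (p-prime , r , 1≤r , refl) p^r≡1 with m^n≡1⇒n≡0∨m≡1 _ r p^r≡1
... | inj₁ refl = contradiction 1≤r λ ()
... | inj₂ refl = ¬prime[1] p-prime

even-primePower⇒pow2 : ∀ {p q} → IsPrimePower p q → 2 ∣ q → IsPrimePower 2 q
even-primePower⇒pow2 (p-prime , r , 1≤r , q≡p^r) 2∣q =
  prime[2] , r , 1≤r , trans q≡p^r (cong (_^ r) (sym (prime∣p^n⇒≡p r prime[2] p-prime (subst (2 ∣_) q≡p^r 2∣q))))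

8∣r²+27t²⇒2∣r×2∣t-mod-4 : ∀ {r} → r < 4 → ∀ {t} → t < 4 → (r * r + 27 * (t * t)) % 8 ≡ 0 → 2 ∣ r × 2 ∣ t
8∣r²+27t²⇒2∣r×2∣t-mod-4 = toWitness {a? = allUpTo? (λ r → allUpTo? (λ t →
  ((r * r + 27 * (t * t)) % 8 ≟ 0) →-dec ((2 ∣? r) ×-dec (2 ∣? t))) 4) 4} _

8∣a²+27b²⇒2∣a×2∣b : ∀ a b → 8 ∣ a * a + 27 * (b * b) → 2 ∣ a × 2 ∣ b
8∣a²+27b²⇒2∣a×2∣b a b 8∣a²+27b² =
  Product.map (lift (a / 4) (m≡m%n+[m/n]*n a 4)) (lift (b / 4) (m≡m%n+[m/n]*n b 4))
              (8∣r²+27t²⇒2∣r×2∣t-mod-4 (m%n<n a 4) (m%n<n b 4) (n∣m⇒m%n≡0 _ 8 8∣residues))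
  where
  lift : ∀ {c r} s → c ≡ r + s * 4 → 2 ∣ r → 2 ∣ c
  lift s refl 2∣r = ∣m∣n⇒∣m+n 2∣r (divides (s * 2) (sym (*-assoc s 2 2)))
  squares-mod-8 : ∀ r s t w → (r + s * 4) * (r + s * 4) + 27 * ((t + w * 4) * (t + w * 4))
                  ≡ (r * s + 2 * (s * s) + 27 * (t * w + 2 * (w * w))) * 8 + (r * r + 27 * (t * t))
  squares-mod-8 = solve-∀
  8∣residues : 8 ∣ a % 4 * (a % 4) + 27 * (b % 4 * (b % 4))
  8∣residues = ∣m+n∣m⇒∣n
    (subst (8 ∣_) (squares-mod-8 (a % 4) (a / 4) (b % 4) (b / 4))
      (subst₂ (λ a b → 8 ∣ a * a + 27 * (b * b)) (m≡m%n+[m/n]*n a 4) (m≡m%n+[m/n]*n b 4) 8∣a²+27b²))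
    (divides (a % 4 * (a / 4) + 2 * (a / 4 * (a / 4)) + 27 * (b % 4 * (b / 4) + 2 * (b / 4 * (b / 4)))) refl)

a²+27b²<27⇒b≡0 : ∀ a b → a * a + 27 * (b * b) < 27 → b ≡ 0
a²+27b²<27⇒b≡0 a zero    _  = refl
a²+27b²<27⇒b≡0 a (suc b) lt = contradiction (≤-trans (m≤m*n 27 (suc b * suc b)) (m≤n+m _ (a * a))) (<⇒≱ lt)

a²+27b²≡2^n⇒b≡0 : ∀ n {a b} → a * a + 27 * (b * b) ≡ 2 ^ n → b ≡ 0
a²+27b²≡2^n⇒b≡0 0 {a} {b} eq = a²+27b²<27⇒b≡0 a b (subst (_< 27) (sym eq) (≤ᵇ⇒≤ 2 27 _))
a²+27b²≡2^n⇒b≡0 1 {a} {b} eq = a²+27b²<27⇒b≡0 a b (subst (_< 27) (sym eq) (≤ᵇ⇒≤ 3 27 _))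
a²+27b²≡2^n⇒b≡0 2 {a} {b} eq = a²+27b²<27⇒b≡0 a b (subst (_< 27) (sym eq) (≤ᵇ⇒≤ 5 27 _))
a²+27b²≡2^n⇒b≡0 (suc (suc (suc n))) {a} {b} eq =
  trans b≡y*2 (cong (_* 2) (a²+27b²≡2^n⇒b≡0 (suc n) {x} {y}
    (*-cancelˡ-≡ _ _ 4 (trans (sym (halve x y)) 4[x²+27y²]≡2^[3+n]))))
  where
  2∣a×2∣b : 2 ∣ a × 2 ∣ b
  2∣a×2∣b = 8∣a²+27b²⇒2∣a×2∣b a b (divides (2 ^ n) (trans eq (trans (^-distribˡ-+-* 2 3 n) (*-comm 8 (2 ^ n)))))
  open _∣_ (proj₁ 2∣a×2∣b) renaming (quotient to x; equality to a≡x*2)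
  open _∣_ (proj₂ 2∣a×2∣b) renaming (quotient to y; equality to b≡y*2)
  4[x²+27y²]≡2^[3+n] : (x * 2) * (x * 2) + 27 * ((y * 2) * (y * 2)) ≡ 4 * 2 ^ suc n
  4[x²+27y²]≡2^[3+n] =
    trans (subst₂ (λ a b → a * a + 27 * (b * b) ≡ 2 ^ (3 + n)) a≡x*2 b≡y*2 eq) (^-distribˡ-+-* 2 2 (suc n))
  halve : ∀ x y → (x * 2) * (x * 2) + 27 * ((y * 2) * (y * 2)) ≡ 4 * (x * x + 27 * (y * y))
  halve = solve-∀

pow2-norm⇒b≡0 : ∀ r {a b} → 4 * 2 ^ r ≡ a * a + 27 * (b * b) → b ≡ 0
pow2-norm⇒b≡0 r {a} {b} eq = a²+27b²≡2^n⇒b≡0 (2 + r) {a} {b} (trans (sym eq) (sym (^-distribˡ-+-* 2 2 r)))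

norm⇒a²≤4q : ∀ {q} a b → 4 * q ≡ a * a + 27 * (b * b) → a * a ≤ 4 * q
norm⇒a²≤4q a b norm = subst (a * a ≤_) (sym norm) (m≤m+n (a * a) (27 * (b * b)))

b≡0⇒a²≡4q : ∀ {q a b} → 4 * q ≡ a * a + 27 * (b * b) → b ≡ 0 → a * a ≡ 4 * q
b≡0⇒a²≡4q {a = a} norm refl = sym (trans norm (+-identityʳ (a * a)))

x²≤km⇒m≤4k : ∀ x k m → x * x ≤ k * m → m ≤ x + 2 * k → m ≤ 4 * k
x²≤km⇒m≤4k x k m x²≤km m≤x+2k with x ≤? 2 * k
... | yes x≤2k = begin
  m             ≤⟨ m≤x+2k ⟩
  x + 2 * k     ≤⟨ +-monoˡ-≤ (2 * k) x≤2k ⟩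
  2 * k + 2 * k ≡⟨ solve (k ∷ []) ⟩
  4 * k         ∎
  where open ≤-Reasoning
... | no x≰2k = contradiction (begin-strict
  2 * k * k               <⟨ m<m+n (2 * k * k) z<s ⟩
  2 * k * k + (1 + 3 * k) ≡⟨ solve (k ∷ []) ⟩
  (1 + k) * (1 + 2 * k)   ≤⟨ *-monoʳ-≤ (1 + k) 2k<x ⟩
  (1 + k) * x             ≤⟨ [1+k]x≤2kk ⟩
  2 * k * k               ∎) (<-irrefl refl)
  where
  open ≤-Reasoning
  2k<x : 2 * k < x
  2k<x = ≰⇒> x≰2k
  [1+k]x≤2kk : (1 + k) * x ≤ 2 * k * k
  [1+k]x≤2kk = +-cancelˡ-≤ (k * x) _ _ (begin
    k * x + (1 + k) * x ≡⟨ solve (k ∷ x ∷ []) ⟩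
    (1 + 2 * k) * x     ≤⟨ *-monoˡ-≤ x 2k<x ⟩
    x * x               ≤⟨ x²≤km ⟩
    k * m               ≤⟨ *-monoʳ-≤ k m≤x+2k ⟩
    k * (x + 2 * k)     ≡⟨ solve (k ∷ x ∷ []) ⟩
    k * x + 2 * k * k   ∎)

c*d≡x*y⇒4d²≡ky² : ∀ c .{{_ : NonZero c}} d x y k → c * d ≡ x * y → 4 * (x * x) ≡ c * c * k
                → 4 * (d * d) ≡ k * (y * y)
c*d≡x*y⇒4d²≡ky² c d x y k cd≡xy 4x²≡c²k = *-cancelˡ-≡ _ _ (c * c) {{m*n≢0 c c}} (begin
  c * c * (4 * (d * d))   ≡⟨ solve (c ∷ d ∷ []) ⟩
  4 * ((c * d) * (c * d)) ≡⟨ cong (λ z → 4 * (z * z)) cd≡xy ⟩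
  4 * ((x * y) * (x * y)) ≡⟨ solve (x ∷ y ∷ []) ⟩
  4 * (x * x) * (y * y)   ≡⟨ cong (_* (y * y)) 4x²≡c²k ⟩
  c * c * k * (y * y)     ≡⟨ *-assoc (c * c) k (y * y) ⟩
  c * c * (k * (y * y))   ∎)
  where open ≡-Reasoning

2^s%3≡1⇒2^s≡1∨2^s≡4 : ∀ s → s ≤ 2 → 2 ^ s % 3 ≡ 1 → 2 ^ s ≡ 1 ⊎ 2 ^ s ≡ 4
2^s%3≡1⇒2^s≡1∨2^s≡4 0 _ _ = inj₁ refl
2^s%3≡1⇒2^s≡1∨2^s≡4 1 _ ()
2^s%3≡1⇒2^s≡1∨2^s≡4 2 _ _ = inj₂ refl
2^s%3≡1⇒2^s≡1∨2^s≡4 (suc (suc (suc _))) (s≤s (s≤s ())) _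

odd-m%3≡1-m<17⇒m≡7∨m≡13 : ∀ {m} → m < 17 → m % 3 ≡ 1 → ¬ 2 ∣ m → m ≢ 1 → m ≡ 7 ⊎ m ≡ 13
odd-m%3≡1-m<17⇒m≡7∨m≡13 = toWitness {a? = allUpTo? (λ m →
  (m % 3 ≟ 1) →-dec (¬? (2 ∣? m) →-dec (¬? (m ≟ 1) →-dec ((m ≟ 7) ⊎-dec (m ≟ 13))))) 17} _

bounded-solutions : ∀ {k m} → k ≡ 1 ⊎ k ≡ 4 → m ≤ 4 * k → m % 3 ≡ 1 → ¬ 2 ∣ m → m ≢ 1
                 → k ≡ 4 × (m ≡ 7 ⊎ m ≡ 13)
bounded-solutions (inj₂ refl) m≤16 m%3≡1 2∤m m≢1 = refl , odd-m%3≡1-m<17⇒m≡7∨m≡13 (s≤s m≤16) m%3≡1 2∤m m≢1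
bounded-solutions (inj₁ refl) m≤4 m%3≡1 2∤m m≢1
  with odd-m%3≡1-m<17⇒m≡7∨m≡13 (s≤s (≤-trans m≤4 (≤ᵇ⇒≤ 4 16 _))) m%3≡1 2∤m m≢1
... | inj₁ refl = ⊥-elim (≤⇒≤ᵇ m≤4)
... | inj₂ refl = ⊥-elim (≤⇒≤ᵇ m≤4)

cross-equation-solutions : ∀ s {k m a} → k ≡ 2 ^ s → k % 3 ≡ 1 → m % 3 ≡ 1 → ¬ 2 ∣ m → m ≢ 1
                    → a * a ≤ 4 * m → 4 * (∣ m - 2 * k ∣ * ∣ m - 2 * k ∣) ≡ k * (a * a)
                    → k ≡ 4 × (m ≡ 7 ⊎ m ≡ 13)
cross-equation-solutions s {k} {m} {a} k≡2^s k%3≡1 m%3≡1 2∤m m≢1 a²≤4m eq =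
  bounded-solutions k≡1∨k≡4 m≤4k m%3≡1 2∤m m≢1
  where
  d = ∣ m - 2 * k ∣
  2∤d : ¬ 2 ∣ d
  2∤d 2∣d = 2∤m (∣∣m-n∣∣n⇒∣m 2∣d (divides k (*-comm 2 k)))
  s≤2 : s ≤ 2
  s≤2 = p^m∣p^n*d⇒m≤n s 2 (divides (a * a) (trans eq (trans (cong (_* (a * a)) k≡2^s) (*-comm (2 ^ s) (a * a)))))
                         (p∤n⇒p∤n*n prime[2] 2∤d)
  k≡1∨k≡4 : k ≡ 1 ⊎ k ≡ 4
  k≡1∨k≡4 = subst (λ k → k ≡ 1 ⊎ k ≡ 4) (sym k≡2^s)
              (2^s%3≡1⇒2^s≡1∨2^s≡4 s s≤2 (subst (λ k → k % 3 ≡ 1) k≡2^s k%3≡1))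
  d²≤km : d * d ≤ k * m
  d²≤km = *-cancelˡ-≤ 4 (begin
    4 * (d * d) ≡⟨ eq ⟩
    k * (a * a) ≤⟨ *-monoʳ-≤ k a²≤4m ⟩
    k * (4 * m) ≡⟨ solve (k ∷ m ∷ []) ⟩
    4 * (k * m) ∎)
    where open ≤-Reasoning
  m≤4k : m ≤ 4 * k
  m≤4k = x²≤km⇒m≤4k d k m d²≤km (m≤∣m-n∣+n m (2 * k))

i*i≡+∣i∣*∣i∣ : ∀ i → i ℤ.* i ≡ + (ℤ.∣ i ∣ * ℤ.∣ i ∣)
i*i≡+∣i∣*∣i∣ i = trans (cong (ℤ._◃ (ℤ.∣ i ∣ * ℤ.∣ i ∣)) (s*s≡+ (ℤ.sign i))) (ℤₚ.+◃n≡+n _)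

+n≡u²+27v²⇒n≡∣u∣²+27∣v∣² : ∀ {n} u v → + n ≡ u ℤ.* u ℤ.+ + 27 ℤ.* (v ℤ.* v)
                           → n ≡ ℤ.∣ u ∣ * ℤ.∣ u ∣ + 27 * (ℤ.∣ v ∣ * ℤ.∣ v ∣)
+n≡u²+27v²⇒n≡∣u∣²+27∣v∣² {n} u v eq = ℤₚ.+-injective (begin
  + n
    ≡⟨ eq ⟩
  u ℤ.* u ℤ.+ + 27 ℤ.* (v ℤ.* v)
    ≡⟨ cong₂ (λ x y → x ℤ.+ + 27 ℤ.* y) (i*i≡+∣i∣*∣i∣ u) (i*i≡+∣i∣*∣i∣ v) ⟩
  + (∣u∣ * ∣u∣) ℤ.+ + 27 ℤ.* + (∣v∣ * ∣v∣)
    ≡⟨ cong (λ z → + (∣u∣ * ∣u∣) ℤ.+ z) (ℤₚ.pos-* 27 (∣v∣ * ∣v∣)) ⟨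
  + (∣u∣ * ∣u∣ + 27 * (∣v∣ * ∣v∣))
    ∎)
  where
  open ≡-Reasoning
  ∣u∣ = ℤ.∣ u ∣
  ∣v∣ = ℤ.∣ v ∣

∣+m-+n∣≡∣m-n∣ : ∀ m n → ℤ.∣ + m ℤ.- + n ∣ ≡ ∣ m - n ∣
∣+m-+n∣≡∣m-n∣ m n with ≤-total m n
... | inj₁ m≤n = begin
  ℤ.∣ + m ℤ.- + n ∣ ≡⟨ cong ℤ.∣_∣ (ℤₚ.[+m]-[+n]≡m⊖n m n) ⟩
  ℤ.∣ m ℤ.⊖ n ∣     ≡⟨ ℤₚ.∣⊖∣-≤ m≤n ⟩
  n ∸ m             ≡⟨ m≤n⇒∣m-n∣≡n∸m m≤n ⟨
  ∣ m - n ∣         ∎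
  where open ≡-Reasoning
... | inj₂ n≤m = begin
  ℤ.∣ + m ℤ.- + n ∣ ≡⟨ cong ℤ.∣_∣ (ℤₚ.[+m]-[+n]≡m⊖n m n) ⟩
  ℤ.∣ m ℤ.⊖ n ∣     ≡⟨ ℤₚ.∣m⊖n∣≡∣n⊖m∣ m n ⟩
  ℤ.∣ n ℤ.⊖ m ∣     ≡⟨ ℤₚ.∣⊖∣-≤ n≤m ⟩
  m ∸ n             ≡⟨ m≤n⇒∣n-m∣≡n∸m n≤m ⟨
  ∣ m - n ∣         ∎
  where open ≡-Reasoning

4[m-n]≡u₁u₂+27*0⇒4∣m-n∣≡∣u₁∣∣u₂∣ : ∀ m n u₁ u₂ {w}
  → + 4 ℤ.* (+ m ℤ.- + n) ≡ u₁ ℤ.* u₂ ℤ.+ + 27 ℤ.* w → w ≡ + 0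
  → 4 * ∣ m - n ∣ ≡ ℤ.∣ u₁ ∣ * ℤ.∣ u₂ ∣
4[m-n]≡u₁u₂+27*0⇒4∣m-n∣≡∣u₁∣∣u₂∣ m n u₁ u₂ eq refl = begin
  4 * ∣ m - n ∣               ≡⟨ cong (4 *_) (∣+m-+n∣≡∣m-n∣ m n) ⟨
  4 * ℤ.∣ + m ℤ.- + n ∣       ≡⟨ ℤₚ.abs-* (+ 4) (+ m ℤ.- + n) ⟨
  ℤ.∣ + 4 ℤ.* (+ m ℤ.- + n) ∣ ≡⟨ cong ℤ.∣_∣ (trans eq (ℤₚ.+-identityʳ (u₁ ℤ.* u₂))) ⟩
  ℤ.∣ u₁ ℤ.* u₂ ∣             ≡⟨ ℤₚ.abs-* u₁ u₂ ⟩
  ℤ.∣ u₁ ∣ * ℤ.∣ u₂ ∣         ∎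
  where open ≡-Reasoning

module _ {q₁ q₂ a₁ a₂ b₁ b₂ : ℕ}
         (q₁%3≡1 : q₁ % 3 ≡ 1) (q₂%3≡1 : q₂ % 3 ≡ 1)
         (norm₁ : 4 * q₁ ≡ a₁ * a₁ + 27 * (b₁ * b₁))
         (norm₂ : 4 * q₂ ≡ a₂ * a₂ + 27 * (b₂ * b₂))
         (cross : b₁ * b₂ ≡ 0 → 4 * ∣ 2 * q₁ - q₂ ∣ ≡ a₁ * a₂)
         where

  pow2-q₁ : IsPrimePower 2 q₁ → ¬ 2 ∣ q₂ → q₂ ≢ 1 → (q₁ , q₂) ≡ (4 , 7) ⊎ (q₁ , q₂) ≡ (4 , 13)
  pow2-q₁ (_ , r , _ , q₁≡2^r) 2∤q₂ q₂≢1 =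
    Product.uncurry (λ q₁≡4 → Sum.map (cong₂ _,_ q₁≡4) (cong₂ _,_ q₁≡4))
      (cross-equation-solutions r {a = a₂} q₁≡2^r q₁%3≡1 q₂%3≡1 2∤q₂ q₂≢1 (norm⇒a²≤4q {q₂} a₂ b₂ norm₂)
        (c*d≡x*y⇒4d²≡ky² 4 ∣ q₂ - 2 * q₁ ∣ a₁ a₂ q₁ 4d≡a₁a₂ 4a₁²≡16q₁))
    where
    b₁≡0 : b₁ ≡ 0
    b₁≡0 = pow2-norm⇒b≡0 r {a₁} (subst (λ q → 4 * q ≡ a₁ * a₁ + 27 * (b₁ * b₁)) q₁≡2^r norm₁)
    4d≡a₁a₂ : 4 * ∣ q₂ - 2 * q₁ ∣ ≡ a₁ * a₂
    4d≡a₁a₂ = trans (cong (4 *_) (∣-∣-comm q₂ (2 * q₁))) (cross (cong (_* b₂) b₁≡0))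
    4a₁²≡16q₁ : 4 * (a₁ * a₁) ≡ 4 * 4 * q₁
    4a₁²≡16q₁ = trans (cong (4 *_) (b≡0⇒a²≡4q {q₁} {a₁} norm₁ b₁≡0)) (sym (*-assoc 4 4 q₁))

  pow2-q₂ : IsPrimePower 2 q₂ → ¬ 2 ∣ q₁ → q₁ ≢ 1 → (q₁ , q₂) ≡ (7 , 16) ⊎ (q₁ , q₂) ≡ (13 , 16)
  pow2-q₂ (_ , 0 , () , _)
  pow2-q₂ (_ , 1 , _ , q₂≡2) _ _ = contradiction (subst (λ q → q % 3 ≡ 1) q₂≡2 q₂%3≡1) λ ()
  pow2-q₂ (_ , suc (suc s) , _ , q₂≡4k) 2∤q₁ q₁≢1 =
    Product.uncurry (λ k≡4 → Sum.map (λ q₁≡7 → cong₂ _,_ q₁≡7 (q₂≡16 k≡4))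
                                     (λ q₁≡13 → cong₂ _,_ q₁≡13 (q₂≡16 k≡4)))
      (cross-equation-solutions s {a = a₁} refl k%3≡1 q₁%3≡1 2∤q₁ q₁≢1 (norm⇒a²≤4q {q₁} a₁ b₁ norm₁)
        (c*d≡x*y⇒4d²≡ky² 8 d a₂ a₁ k 8d≡a₂a₁ 4a₂²≡64k))
    where
    k = 2 ^ s
    d = ∣ q₁ - 2 * k ∣
    q₂≡16 : k ≡ 4 → q₂ ≡ 16
    q₂≡16 k≡4 = trans q₂≡4k (cong (λ k → 2 * (2 * k)) k≡4)
    quadruple : ∀ k → 2 * (2 * k) ≡ k + k * 3
    quadruple = solve-∀
    k%3≡1 : k % 3 ≡ 1
    k%3≡1 = begin
      k % 3             ≡⟨ [m+kn]%n≡m%n k k 3 ⟨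
      (k + k * 3) % 3   ≡⟨ cong (_% 3) (trans q₂≡4k (quadruple k)) ⟨
      q₂ % 3            ≡⟨ q₂%3≡1 ⟩
      1                 ∎
      where open ≡-Reasoning
    b₂≡0 : b₂ ≡ 0
    b₂≡0 = pow2-norm⇒b≡0 (2 + s) {a₂} (subst (λ q → 4 * q ≡ a₂ * a₂ + 27 * (b₂ * b₂)) q₂≡4k norm₂)
    8d≡a₂a₁ : 8 * d ≡ a₂ * a₁
    8d≡a₂a₁ = begin
      8 * d                          ≡⟨ *-assoc 4 2 d ⟩
      4 * (2 * d)                    ≡⟨ cong (4 *_) (*-distribˡ-∣-∣ 2 q₁ (2 * k)) ⟩
      4 * ∣ 2 * q₁ - 2 * (2 * k) ∣   ≡⟨ cong (λ q → 4 * ∣ 2 * q₁ - q ∣) q₂≡4k ⟨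
      4 * ∣ 2 * q₁ - q₂ ∣            ≡⟨ cross (trans (cong (b₁ *_) b₂≡0) (*-zeroʳ b₁)) ⟩
      a₁ * a₂                        ≡⟨ *-comm a₁ a₂ ⟩
      a₂ * a₁                        ∎
      where open ≡-Reasoning
    sixteenfold : ∀ k → 4 * (4 * (2 * (2 * k))) ≡ 8 * 8 * k
    sixteenfold = solve-∀
    4a₂²≡64k : 4 * (a₂ * a₂) ≡ 8 * 8 * k
    4a₂²≡64k = trans (cong (4 *_) (trans (b≡0⇒a²≡4q {q₂} {a₂} norm₂ b₂≡0) (cong (4 *_) q₂≡4k))) (sixteenfold k)

  classify : ∀ {p₁ p₂} → IsPrimePower p₁ q₁ → IsPrimePower p₂ q₂ → Coprime q₁ q₂ → 2 ∣ q₁ * q₂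
           → (q₁ , q₂) ≡ (4 , 7) ⊎ (q₁ , q₂) ≡ (4 , 13) ⊎ (q₁ , q₂) ≡ (7 , 16) ⊎ (q₁ , q₂) ≡ (13 , 16)
  classify pp₁ pp₂ q₁⊥q₂ 2∣q₁q₂ with euclidsLemma q₁ q₂ prime[2] 2∣q₁q₂
  ... | inj₁ 2∣q₁ = Sum.map₂ inj₁ (pow2-q₁ (even-primePower⇒pow2 pp₁ 2∣q₁)
    (λ 2∣q₂ → contradiction (q₁⊥q₂ (2∣q₁ , 2∣q₂)) λ ()) (primePower≢1 pp₂))
  ... | inj₂ 2∣q₂ = inj₂ (inj₂ (pow2-q₂ (even-primePower⇒pow2 pp₂ 2∣q₂)
    (λ 2∣q₁ → contradiction (q₁⊥q₂ (2∣q₁ , 2∣q₂)) λ ()) (primePower≢1 pp₁)))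

lemma4p7 : (p₁ p₂ q₁ q₂ : ℕ) → IsPrimePower p₁ q₁ → IsPrimePower p₂ q₂
    → Coprime q₁ q₂ → q₁ % 3 ≡ 1 → q₂ % 3 ≡ 1
    → (F₁ : FiniteField q₁) (F₂ : FiniteField q₂)
    → (α₁ : FiniteField.Carrier F₁) (α₂ : FiniteField.Carrier F₂)
    → Primitive F₁ α₁ → Primitive F₂ α₂
    → (u₁ u₂ v₁ v₂ : ℤ) → IsU3 p₁ q₁ u₁ → IsU3 p₂ q₂ u₂
    → IsV3 F₁ α₁ u₁ v₁ → IsV3 F₂ α₂ u₂ v₂
    → + 4 ℤ.* (+ (2 ℕ.* q₁) ℤ.- + q₂) ≡ (u₁ ℤ.* u₂) ℤ.+ (+ 27 ℤ.* (v₁ ℤ.* v₂))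
    → 2 ∣ (q₁ ℕ.* q₂)
    → ((q₁ , q₂) ≡ (4 , 7)) ⊎ ((q₁ , q₂) ≡ (4 , 13)) ⊎ ((q₁ , q₂) ≡ (7 , 16)) ⊎ ((q₁ , q₂) ≡ (13 , 16))
lemma4p7 p₁ p₂ q₁ q₂ pp₁ pp₂ q₁⊥q₂ q₁%3≡1 q₂%3≡1 _ _ _ _ _ _ u₁ u₂ v₁ v₂ _ _ (norm₁ , _) (norm₂ , _) cross 2∣q₁q₂ =
  classify {a₁ = ℤ.∣ u₁ ∣} {ℤ.∣ u₂ ∣} {ℤ.∣ v₁ ∣} {ℤ.∣ v₂ ∣} q₁%3≡1 q₂%3≡1
    (+n≡u²+27v²⇒n≡∣u∣²+27∣v∣² u₁ v₁ norm₁) (+n≡u²+27v²⇒n≡∣u∣²+27∣v∣² u₂ v₂ norm₂) cross-ℕ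
    pp₁ pp₂ q₁⊥q₂ 2∣q₁q₂
  where
  cross-ℕ : ℤ.∣ v₁ ∣ * ℤ.∣ v₂ ∣ ≡ 0 → 4 * ∣ 2 * q₁ - q₂ ∣ ≡ ℤ.∣ u₁ ∣ * ℤ.∣ u₂ ∣
  cross-ℕ ∣v₁∣∣v₂∣≡0 = 4[m-n]≡u₁u₂+27*0⇒4∣m-n∣≡∣u₁∣∣u₂∣ (2 * q₁) q₂ u₁ u₂ cross
                         (ℤₚ.∣i∣≡0⇒i≡0 (trans (ℤₚ.abs-* v₁ v₂) ∣v₁∣∣v₂∣≡0))
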